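{- Let $G$ be a connected graph with $n$ vertices, $m$ edges, $N_1\ge 0$ pendent vertices (vertices of degree $1$) and cyclomatic number $c=m-n+1$ with $1\le c\le\frac{n+2}{2}$. Then $S(G)\le 2(N_1+2c-2)$, with equality if and only if $G$ is unicyclic.
   Context: A unicyclic graph is a connected graph with $c=1$. With degrees $d_1,\dots,d_n$, $S(G)=\sum_i|d_i-\frac{2m}{n}|$. -}

module Defs where

open import Data.Bool using (Bool; true; false; if_then_else_)
open import Data.Nat using (ℕ; zero; suc; _+_; _*_; _∸_; _<ᵇ_; _≡ᵇ_)
open import Data.Fin using (Fin; toℕ)
open import Data.List using (List; []; _∷_; map; allFin)
open import Data.Nat.ListAction using (sum)
open import Data.Integer using (+_)
open import Data.Rational as ℚ using (ℚ; 0ℚ; _/_)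
open import Data.Product using (_×_)
open import Relation.Binary.PropositionalEquality using (_≡_)

record Graph (n : ℕ) : Set where
  field
    adj   : Fin n → Fin n → Bool
    sym   : ∀ i j → adj i j ≡ adj j i
    irrfl : ∀ i → adj i i ≡ false
open Graph public

count : {A : Set} → (A → Bool) → List A → ℕ
count p []       = 0
count p (x ∷ xs) = (if p x then 1 else 0) + count p xs

module _ {n : ℕ} (G : Graph n) where

  degree : Fin n → ℕ
  degree i = count (adj G i) (allFin n)

  edges : ℕ
  edges = sum (map (λ i → count (λ j → if toℕ i <ᵇ toℕ j then adj G i j else false)
                                (allFin n))
                   (allFin n))

  pendent : ℕ
  pendent = count (λ i → degree i ≡ᵇ 1) (allFin n)

  -- cyclomatic number c = m - n + 1 (as a natural number; meaningful when m + 1 ≥ n,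
  -- which holds for connected graphs)
  cyclomatic : ℕ
  cyclomatic = (edges + 1) ∸ n

  data Reach : Fin n → Fin n → Set where
    here : ∀ {i} → Reach i i
    step : ∀ {i j k} → adj G i j ≡ true → Reach j k → Reach i k

  Connected : Set
  Connected = ∀ i j → Reach i j

  Unicyclic : Set
  Unicyclic = Connected × (cyclomatic ≡ 1)

sumℚ : List ℚ → ℚ
sumℚ []       = 0ℚ
sumℚ (x ∷ xs) = x ℚ.+ sumℚ xs

S : {k : ℕ} → Graph (suc k) → ℚ
S {k} G = sumℚ (map (λ i → ℚ.∣ (+ degree G i) / 1 ℚ.- (+ (2 * edges G)) / suc k ∣)
                    (allFin (suc k)))

{-# OPTIONS --safe #-}
module Submission where

open import Defs
open import Data.Nat using (ℕ; suc; _+_; _*_; _∸_; _≤_)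
open import Data.Integer using (+_)
open import Data.Rational using (_/_)
open import Data.Rational as ℚ using ()
open import Data.Product using (_×_)
open import Relation.Binary.PropositionalEquality using (_≡_)
open import Function.Bundles using (_⇔_)

open import Data.Bool using (Bool; true; false; if_then_else_; T)
open import Data.Nat using (zero; _<_; _<ᵇ_; _≡ᵇ_; z≤n; s≤s)
import Data.Nat.Properties as ℕ
open import Data.Nat.Tactic.RingSolver using (solve)
open import Data.Integer as ℤ using (_⊖_)
import Data.Integer.Properties as ℤ
open import Data.Rational using (ℚ; toℚᵘ)
import Data.Rational.Properties as ℚ
open import Data.Rational.Unnormalised as ℚᵘ using (mkℚᵘ; *≡*; *≤*) renaming (_≃_ to _≃ᵘ_)
import Data.Rational.Unnormalised.Properties as ℚᵘ
open import Data.Fin using (Fin; toℕ)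
import Data.Fin.Properties as Fin
open import Data.List using (List; []; _∷_; map; allFin; tabulate)
open import Data.List.Properties using (map-tabulate)
import Data.Nat.ListAction as List
open import Data.List.Membership.Propositional using (_∈_)
open import Data.List.Membership.Propositional.Properties using (∈-allFin)
open import Data.List.Relation.Unary.Any using (here; there)
open import Data.Product using (_,_; proj₂)
open import Data.Sum using ([_,_]′)
open import Data.Empty using (⊥-elim)
open import Relation.Nullary using (¬_)
open import Function.Base using (_∘_; _$_)
open import Function.Bundles using (mk⇔)
import Function.Properties.Equivalence as ⇔
open import Relation.Binary.PropositionalEquality
  as ≡ using (refl; trans; cong; cong₂; subst; subst₂; module ≡-Reasoning)
open import Algebra.Properties.Semiring.Sum ℕ.+-*-semiring
  using (sum-syntax; sum-cong-≗; ∑-distrib-+; ∑-comm; *-distribˡ-sum)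

-- Write m = n + (c - 1) and a = 2 (c - 1), so that the average degree 2m/n is 2 + a/n,
-- where 0 ≤ a ≤ n because c ≤ (n + 2)/2.  A vertex of degree 1 deviates from it by
-- 1 + a/n, one of degree 2 by a/n and one of degree d ≥ 3 by d - 2 - a/n (no vertex
-- is isolated).  Summing and using the handshake lemma gives
--   n S(G) + 2a N₃ = 2 (N₁ + a) n,
-- with N₃ the number of vertices of degree at least 3.  So S(G) ≤ 2 (N₁ + 2c - 2), with
-- equality iff a = 0 or N₃ = 0; the latter forces 2m ≤ 2n, so in either case a = 0,
-- i.e. c = 1.

𝟙 : Bool → ℕ
𝟙 b = if b then 1 else 0

large : ℕ → ℕ
large d = 𝟙 (2 <ᵇ d)

large≡0⇒≤2 : ∀ {d} → large d ≡ 0 → d ≤ 2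
large≡0⇒≤2 {0}                 _ = z≤n
large≡0⇒≤2 {1}                 _ = s≤s z≤n
large≡0⇒≤2 {2}                 _ = ℕ.≤-refl
large≡0⇒≤2 {suc (suc (suc _))} ()

x+t≡y⇒[x≡y⇔t≡0] : ∀ {x t y} → x + t ≡ y → x ≡ y ⇔ t ≡ 0
x+t≡y⇒[x≡y⇔t≡0] {x} {t} {y} x+t≡y = mk⇔
  (λ x≡y → ℕ.+-cancelˡ-≡ x t 0 (trans x+t≡y (trans (≡.sym x≡y) (≡.sym (ℕ.+-identityʳ x)))))
  (λ t≡0 → trans (≡.sym (ℕ.+-identityʳ x)) (trans (cong (_+_ x) (≡.sym t≡0)) x+t≡y))

∑-const : ∀ n c → ∑[ i < n ] c ≡ n * c
∑-const zero    c = refl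
∑-const (suc n) c = cong (_+_ c) (∑-const n c)

∑-mono-≤ : ∀ {n} {f g : Fin n → ℕ} → (∀ i → f i ≤ g i) → ∑[ i < n ] f i ≤ ∑[ i < n ] g i
∑-mono-≤ {zero}  f≤g = z≤n
∑-mono-≤ {suc n} f≤g = ℕ.+-mono-≤ (f≤g Fin.zero) (∑-mono-≤ (f≤g ∘ Fin.suc))

∑≡0⇒≡0 : ∀ {n} (f : Fin n → ℕ) → ∑[ i < n ] f i ≡ 0 → ∀ i → f i ≡ 0
∑≡0⇒≡0 f ∑f≡0 Fin.zero    = ℕ.m+n≡0⇒m≡0 (f Fin.zero) ∑f≡0
∑≡0⇒≡0 f ∑f≡0 (Fin.suc i) = ∑≡0⇒≡0 (f ∘ Fin.suc) (ℕ.m+n≡0⇒n≡0 (f Fin.zero) ∑f≡0) i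

sum-tabulate : ∀ {n} (f : Fin n → ℕ) → List.sum (tabulate f) ≡ ∑[ i < n ] f i
sum-tabulate {zero}  f = refl
sum-tabulate {suc n} f = cong (_+_ (f Fin.zero)) (sum-tabulate (f ∘ Fin.suc))

sum-map-allFin : ∀ {n} (f : Fin n → ℕ) → List.sum (map f (allFin n)) ≡ ∑[ i < n ] f i
sum-map-allFin f = trans (cong List.sum (map-tabulate (λ i → i) f)) (sum-tabulate f)

count≡sum-map : {A : Set} (p : A → Bool) (xs : List A) → count p xs ≡ List.sum (map (𝟙 ∘ p) xs)
count≡sum-map p []       = refl
count≡sum-map p (x ∷ xs) = cong (_+_ (𝟙 (p x))) (count≡sum-map p xs)

count-allFin : ∀ {n} (p : Fin n → Bool) → count p (allFin n) ≡ ∑[ i < n ] 𝟙 (p i)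
count-allFin p = trans (count≡sum-map p (allFin _)) (sum-map-allFin (𝟙 ∘ p))

∈⇒1≤count : {A : Set} (p : A → Bool) {x : A} {xs : List A} → x ∈ xs → p x ≡ true → 1 ≤ count p xs
∈⇒1≤count p (here refl) px rewrite px = s≤s z≤n
∈⇒1≤count p {xs = y ∷ _} (there x∈) px = ℕ.≤-trans (∈⇒1≤count p x∈ px) (ℕ.m≤n+m _ (𝟙 (p y)))

module _ {n : ℕ} (G : Graph n) where

  private
    forward : Fin n → Fin n → Bool
    forward i j = if toℕ i <ᵇ toℕ j then adj G i j else false

  adj-split : ∀ i j → 𝟙 (adj G i j) ≡ 𝟙 (forward i j) + 𝟙 (forward j i)
  adj-split i j with toℕ i <ᵇ toℕ j in i<ᵇj | toℕ j <ᵇ toℕ i in j<ᵇi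
  ... | true  | true  = ⊥-elim (ℕ.<-asym (<ᵇ⇒< {toℕ i} i<ᵇj) (<ᵇ⇒< {toℕ j} j<ᵇi))
    where
    <ᵇ⇒< : ∀ {x y} → (x <ᵇ y) ≡ true → x < y
    <ᵇ⇒< {x} {y} eq = ℕ.<ᵇ⇒< x y (subst T (≡.sym eq) _)
  ... | true  | false = ≡.sym (ℕ.+-identityʳ _)
  ... | false | true  = cong 𝟙 (Graph.sym G i j)
  ... | false | false = cong 𝟙 (trans (cong (adj G i) (≡.sym i≡j)) (irrfl G i))
    where
    ≮ : ∀ {x y} → (x <ᵇ y) ≡ false → ¬ x < y
    ≮ eq x<y = subst T eq (ℕ.<⇒<ᵇ x<y)
    i≡j : i ≡ j
    i≡j = Fin.toℕ-injective (ℕ.≤-antisym (ℕ.≮⇒≥ (≮ j<ᵇi)) (ℕ.≮⇒≥ (≮ i<ᵇj)))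

  handshake : ∑[ i < n ] degree G i ≡ 2 * edges G
  handshake = begin
    ∑[ i < n ] degree G i
      ≡⟨ sum-cong-≗ (λ i → count-allFin (adj G i)) ⟩
    ∑[ i < n ] ∑[ j < n ] 𝟙 (adj G i j)
      ≡⟨ sum-cong-≗ (λ i → trans (sum-cong-≗ (adj-split i))
                                 (∑-distrib-+ (𝟙 ∘ forward i) (λ j → 𝟙 (forward j i)))) ⟩
    ∑[ i < n ] (∑[ j < n ] 𝟙 (forward i j) + ∑[ j < n ] 𝟙 (forward j i))
      ≡⟨ ∑-distrib-+ (λ i → ∑[ j < n ] 𝟙 (forward i j)) (λ i → ∑[ j < n ] 𝟙 (forward j i)) ⟩
    F + ∑[ i < n ] ∑[ j < n ] 𝟙 (forward j i)
      ≡⟨ cong (_+_ F) (∑-comm (λ i j → 𝟙 (forward j i))) ⟩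
    F + F
      ≡⟨ cong (_+_ F) (≡.sym (ℕ.+-identityʳ F)) ⟩
    2 * F
      ≡⟨ cong (2 *_) edges≡F ⟨
    2 * edges G ∎
    where
    open ≡-Reasoning
    F : ℕ
    F = ∑[ i < n ] ∑[ j < n ] 𝟙 (forward i j)
    edges≡F : edges G ≡ F
    edges≡F = trans (sum-map-allFin (λ i → count (forward i) (allFin n)))
                    (sum-cong-≗ (λ i → count-allFin (forward i)))

connected⇒degree≥1 : ∀ {k} (G : Graph (suc (suc k))) → Connected G → ∀ i → 1 ≤ degree G i
connected⇒degree≥1 G con Fin.zero with con Fin.zero (Fin.suc Fin.zero)
... | step {j = j} e _ = ∈⇒1≤count (adj G Fin.zero) (∈-allFin j) e
connected⇒degree≥1 G con (Fin.suc i) with con (Fin.suc i) Fin.zero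
... | step {j = j} e _ = ∈⇒1≤count (adj G (Fin.suc i)) (∈-allFin j) e

-- Deviation of a degree sequence from its average 2 + a/n

∣m⊖[m+n]∣≡n : ∀ m n → ℤ.∣ m ⊖ (m + n) ∣ ≡ n
∣m⊖[m+n]∣≡n m n = trans (ℤ.∣⊖∣-≤ (ℕ.m≤m+n m n)) (ℕ.m+n∸m≡n m n)

∣[m+n]⊖m∣≡n : ∀ m n → ℤ.∣ (m + n) ⊖ m ∣ ≡ n
∣[m+n]⊖m∣≡n m n = trans (ℤ.∣m⊖n∣≡∣n⊖m∣ (m + n) m) (∣m⊖[m+n]∣≡n m n)

-- Scaled by n, with the terms of both sides moved so that no subtraction occurs.
deviation-identity : ∀ {n a} d → a ≤ n → 1 ≤ d →
  ℤ.∣ d * n ⊖ (n + n + a) ∣ + (2 * a * large d + 2 * n) ≡ n * d + (2 * n * 𝟙 (d ≡ᵇ 1) + a)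
deviation-identity {n} {a} 1 _ _ = begin
  ℤ.∣ 1 * n ⊖ (n + n + a) ∣ + (2 * a * 0 + 2 * n)
    ≡⟨ cong (λ x → ℤ.∣ 1 * n ⊖ x ∣ + (2 * a * 0 + 2 * n)) average ⟩
  ℤ.∣ 1 * n ⊖ (1 * n + (n + a)) ∣ + (2 * a * 0 + 2 * n)
    ≡⟨ cong (_+ (2 * a * 0 + 2 * n)) (∣m⊖[m+n]∣≡n (1 * n) (n + a)) ⟩
  n + a + (2 * a * 0 + 2 * n)
    ≡⟨ solve (n ∷ a ∷ []) ⟩
  n * 1 + (2 * n * 1 + a) ∎
  where
  open ≡-Reasoning
  average : n + n + a ≡ 1 * n + (n + a)
  average = solve (n ∷ a ∷ [])
deviation-identity {n} {a} 2 _ _ = begin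
  ℤ.∣ 2 * n ⊖ (n + n + a) ∣ + (2 * a * 0 + 2 * n)
    ≡⟨ cong (λ x → ℤ.∣ 2 * n ⊖ x ∣ + (2 * a * 0 + 2 * n)) average ⟩
  ℤ.∣ 2 * n ⊖ (2 * n + a) ∣ + (2 * a * 0 + 2 * n)
    ≡⟨ cong (_+ (2 * a * 0 + 2 * n)) (∣m⊖[m+n]∣≡n (2 * n) a) ⟩
  a + (2 * a * 0 + 2 * n)
    ≡⟨ solve (n ∷ a ∷ []) ⟩
  n * 2 + (2 * n * 0 + a) ∎
  where
  open ≡-Reasoning
  average : n + n + a ≡ 2 * n + a
  average = solve (n ∷ a ∷ [])
deviation-identity {n} {a} (suc (suc (suc e))) a≤n _
  with r ← n ∸ a | refl ← ℕ.m+[n∸m]≡n a≤n = begin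
  ℤ.∣ (3 + e) * n ⊖ (n + n + a) ∣ + (2 * a * 1 + 2 * n)
    ≡⟨ cong (λ x → ℤ.∣ x ⊖ (n + n + a) ∣ + (2 * a * 1 + 2 * n)) degree≡ ⟩
  ℤ.∣ (n + n + a + (r + e * n)) ⊖ (n + n + a) ∣ + (2 * a * 1 + 2 * n)
    ≡⟨ cong (_+ (2 * a * 1 + 2 * n)) (∣[m+n]⊖m∣≡n (n + n + a) (r + e * n)) ⟩
  r + e * n + (2 * a * 1 + 2 * n)
    ≡⟨ solve (e ∷ a ∷ r ∷ []) ⟩
  n * (3 + e) + (2 * n * 0 + a) ∎
  where
  open ≡-Reasoning
  degree≡ : (3 + e) * n ≡ n + n + a + (r + e * n)
  degree≡ = solve (e ∷ a ∷ r ∷ [])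

module _ {n : ℕ} (d : Fin n → ℕ) {a : ℕ} (∑d≡ : ∑[ i < n ] d i ≡ n + n + a) where

  deviation-sum : a ≤ n → (∀ i → 1 ≤ d i) →
    ∑[ i < n ] ℤ.∣ d i * n ⊖ (n + n + a) ∣ + 2 * a * ∑[ i < n ] large (d i)
      ≡ 2 * (∑[ i < n ] 𝟙 (d i ≡ᵇ 1) + a) * n
  deviation-sum a≤n d≥1 = ℕ.+-cancelʳ-≡ (n * (2 * n)) _ _ $ begin
    D + 2 * a * L + n * (2 * n)
      ≡⟨ ℕ.+-assoc D (2 * a * L) (n * (2 * n)) ⟩
    D + (2 * a * L + n * (2 * n))
      ≡⟨ cong (_+_ D) (cong₂ _+_ (*-distribˡ-sum (2 * a) (large ∘ d)) (≡.sym (∑-const n (2 * n)))) ⟩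
    D + (∑[ i < n ] (2 * a * large (d i)) + ∑[ i < n ] (2 * n))
      ≡⟨ cong (_+_ D) (∑-distrib-+ (λ i → 2 * a * large (d i)) (λ _ → 2 * n)) ⟨
    D + ∑[ i < n ] (2 * a * large (d i) + 2 * n)
      ≡⟨ ∑-distrib-+ deviation (λ i → 2 * a * large (d i) + 2 * n) ⟨
    ∑[ i < n ] (deviation i + (2 * a * large (d i) + 2 * n))
      ≡⟨ sum-cong-≗ (λ i → deviation-identity (d i) a≤n (d≥1 i)) ⟩
    ∑[ i < n ] (n * d i + (2 * n * 𝟙 (d i ≡ᵇ 1) + a))
      ≡⟨ ∑-distrib-+ (λ i → n * d i) (λ i → 2 * n * 𝟙 (d i ≡ᵇ 1) + a) ⟩
    ∑[ i < n ] (n * d i) + ∑[ i < n ] (2 * n * 𝟙 (d i ≡ᵇ 1) + a)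
      ≡⟨ cong (_+_ _) (∑-distrib-+ (λ i → 2 * n * 𝟙 (d i ≡ᵇ 1)) (λ _ → a)) ⟩
    ∑[ i < n ] (n * d i) + (∑[ i < n ] (2 * n * 𝟙 (d i ≡ᵇ 1)) + ∑[ i < n ] a)
      ≡⟨ cong₂ _+_ (*-distribˡ-sum n d)
                   (cong₂ _+_ (*-distribˡ-sum (2 * n) (λ i → 𝟙 (d i ≡ᵇ 1))) (≡.sym (∑-const n a))) ⟨
    n * ∑[ i < n ] d i + (2 * n * P + n * a)
      ≡⟨ cong (λ s → n * s + (2 * n * P + n * a)) ∑d≡ ⟩
    n * (n + n + a) + (2 * n * P + n * a)
      ≡⟨ regroup P ⟩
    2 * (P + a) * n + n * (2 * n) ∎
    where
    open ≡-Reasoning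
    deviation : Fin n → ℕ
    deviation i = ℤ.∣ d i * n ⊖ (n + n + a) ∣
    D : ℕ
    D = ∑[ i < n ] deviation i
    L : ℕ
    L = ∑[ i < n ] large (d i)
    P : ℕ
    P = ∑[ i < n ] 𝟙 (d i ≡ᵇ 1)
    regroup : ∀ p → n * (n + n + a) + (2 * n * p + n * a) ≡ 2 * (p + a) * n + n * (2 * n)
    regroup p = solve (n ∷ a ∷ p ∷ [])

  no-large⇒a≡0 : ∑[ i < n ] large (d i) ≡ 0 → a ≡ 0
  no-large⇒a≡0 L≡0 = ℕ.n≤0⇒n≡0 (ℕ.+-cancelˡ-≤ (n + n) a 0 (begin
    n + n + a       ≡⟨ ∑d≡ ⟨
    ∑[ i < n ] d i  ≤⟨ ∑-mono-≤ (λ i → large≡0⇒≤2 (∑≡0⇒≡0 (large ∘ d) L≡0 i)) ⟩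
    ∑[ i < n ] 2    ≡⟨ ∑-const n 2 ⟩
    n * 2           ≡⟨ solve (n ∷ []) ⟩
    n + n + 0       ∎))
    where open ℕ.≤-Reasoning

  2a*large≡0⇔a≡0 : 2 * a * ∑[ i < n ] large (d i) ≡ 0 ⇔ a ≡ 0
  2a*large≡0⇔a≡0 = mk⇔
    (λ 2aL≡0 → [ ℕ.m+n≡0⇒m≡0 a , no-large⇒a≡0 ]′ (ℕ.m*n≡0⇒m≡0∨n≡0 (2 * a) 2aL≡0))
    (λ { refl → refl })

-- S(G) as a fraction with denominator n

toℚᵘ-/ : ∀ i k → toℚᵘ (i / suc k) ≃ᵘ mkℚᵘ i k
toℚᵘ-/ i k = ℚ.toℚᵘ-fromℚᵘ (mkℚᵘ i k)

toℚᵘ-∣x-y/n∣ : ∀ x y k →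
  toℚᵘ (ℚ.∣ (+ x) / 1 ℚ.- (+ y) / suc k ∣) ≃ᵘ mkℚᵘ (+ ℤ.∣ x * suc k ⊖ y ∣) k
toℚᵘ-∣x-y/n∣ x y k = begin-equality
  toℚᵘ (ℚ.∣ p ℚ.- q ∣)              ≃⟨ ℚ.toℚᵘ-homo-∣-∣ (p ℚ.- q) ⟩
  ℚᵘ.∣ toℚᵘ (p ℚ.- q) ∣             ≃⟨ ℚᵘ.∣-∣-cong (ℚ.toℚᵘ-homo-+ p (ℚ.- q)) ⟩
  ℚᵘ.∣ toℚᵘ p ℚᵘ.+ toℚᵘ (ℚ.- q) ∣   ≃⟨ ℚᵘ.∣-∣-cong (ℚᵘ.+-congʳ (toℚᵘ p) (ℚ.toℚᵘ-homo‿- q)) ⟩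
  ℚᵘ.∣ toℚᵘ p ℚᵘ.- toℚᵘ q ∣         ≃⟨ ℚᵘ.∣-∣-cong (ℚᵘ.+-cong (toℚᵘ-/ (+ x) 0) (ℚᵘ.-‿cong (toℚᵘ-/ (+ y) k))) ⟩
  ℚᵘ.∣ mkℚᵘ (+ x) 0 ℚᵘ.- mkℚᵘ (+ y) k ∣
    ≃⟨ *≡* (cong₂ (λ i j → + ℤ.∣ i ∣ ℤ.* + j) numerator (≡.sym (ℕ.*-identityˡ n))) ⟩
  mkℚᵘ (+ ℤ.∣ x * n ⊖ y ∣) k        ∎
  where
  open ℚᵘ.≤-Reasoning
  n : ℕ
  n = suc k
  p q : ℚ
  p = (+ x) / 1
  q = (+ y) / n
  numerator : + x ℤ.* + n ℤ.+ ℤ.- + y ℤ.* + 1 ≡ x * n ⊖ y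
  numerator = trans (cong₂ ℤ._+_ (≡.sym (ℤ.pos-* x n)) (ℤ.*-identityʳ (ℤ.- + y))) (ℤ.m-n≡m⊖n (x * n) y)

mkℚᵘ-+ : ∀ a b k → mkℚᵘ (+ a) k ℚᵘ.+ mkℚᵘ (+ b) k ≃ᵘ mkℚᵘ (+ (a + b)) k
mkℚᵘ-+ a b k = *≡* (begin
  (+ a ℤ.* + n ℤ.+ + b ℤ.* + n) ℤ.* + n
    ≡⟨ cong (ℤ._* + n) (cong₂ ℤ._+_ (ℤ.pos-* a n) (ℤ.pos-* b n)) ⟨
  (+ (a * n) ℤ.+ + (b * n)) ℤ.* + n
    ≡⟨ cong (ℤ._* + n) (ℤ.pos-+ (a * n) (b * n)) ⟨
  + (a * n + b * n) ℤ.* + n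
    ≡⟨ ℤ.pos-* (a * n + b * n) n ⟨
  + ((a * n + b * n) * n)
    ≡⟨ cong (λ m → + (m * n)) (ℕ.*-distribʳ-+ n a b) ⟨
  + ((a + b) * n * n)
    ≡⟨ cong +_ (ℕ.*-assoc (a + b) n n) ⟩
  + ((a + b) * (n * n))
    ≡⟨ ℤ.pos-* (a + b) (n * n) ⟩
  + (a + b) ℤ.* + (n * n) ∎)
  where
  open ≡-Reasoning
  n : ℕ
  n = suc k

toℚᵘ-sumℚ : {A : Set} (k : ℕ) (f : A → ℚ) (g : A → ℕ) → (∀ x → toℚᵘ (f x) ≃ᵘ mkℚᵘ (+ g x) k) →
  ∀ xs → toℚᵘ (sumℚ (map f xs)) ≃ᵘ mkℚᵘ (+ List.sum (map g xs)) k
toℚᵘ-sumℚ k f g f≃g []       = *≡* refl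
toℚᵘ-sumℚ k f g f≃g (x ∷ xs) = begin-equality
  toℚᵘ (f x ℚ.+ sumℚ (map f xs))                               ≃⟨ ℚ.toℚᵘ-homo-+ (f x) (sumℚ (map f xs)) ⟩
  toℚᵘ (f x) ℚᵘ.+ toℚᵘ (sumℚ (map f xs))                       ≃⟨ ℚᵘ.+-cong (f≃g x) (toℚᵘ-sumℚ k f g f≃g xs) ⟩
  mkℚᵘ (+ g x) k ℚᵘ.+ mkℚᵘ (+ List.sum (map g xs)) k           ≃⟨ mkℚᵘ-+ (g x) (List.sum (map g xs)) k ⟩
  mkℚᵘ (+ (g x + List.sum (map g xs))) k                       ∎
  where open ℚᵘ.≤-Reasoning

toℚᵘ-S : ∀ {k} (G : Graph (suc k)) →
  toℚᵘ (S G) ≃ᵘ mkℚᵘ (+ ∑[ i < suc k ] ℤ.∣ degree G i * suc k ⊖ 2 * edges G ∣) k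
toℚᵘ-S {k} G = subst (λ X → toℚᵘ (S G) ≃ᵘ mkℚᵘ (+ X) k) (sum-map-allFin deviation)
  (toℚᵘ-sumℚ k _ deviation (λ i → toℚᵘ-∣x-y/n∣ (degree G i) (2 * edges G) k) (allFin (suc k)))
  where
  deviation : Fin (suc k) → ℕ
  deviation i = ℤ.∣ degree G i * suc k ⊖ 2 * edges G ∣

module _ {s : ℚ} {X k : ℕ} (s≃X/n : toℚᵘ s ≃ᵘ mkℚᵘ (+ X) k) (Y : ℕ) where

  numerator-≤⇒≤ : X ≤ Y * suc k → s ℚ.≤ (+ Y) / 1
  numerator-≤⇒≤ X≤Yn = ℚ.toℚᵘ-cancel-≤ (begin
    toℚᵘ s           ≃⟨ s≃X/n ⟩
    mkℚᵘ (+ X) k     ≤⟨ *≤* (subst₂ ℤ._≤_ (≡.sym (ℤ.*-identityʳ (+ X))) (ℤ.pos-* Y (suc k)) (ℤ.+≤+ X≤Yn)) ⟩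
    mkℚᵘ (+ Y) 0     ≃⟨ toℚᵘ-/ (+ Y) 0 ⟨
    toℚᵘ ((+ Y) / 1) ∎)
    where open ℚᵘ.≤-Reasoning

  ≡⇔numerator-≡ : s ≡ (+ Y) / 1 ⇔ X ≡ Y * suc k
  ≡⇔numerator-≡ = mk⇔ to from
    where
    to : s ≡ (+ Y) / 1 → X ≡ Y * suc k
    to refl with ℚᵘ.≃-trans (ℚᵘ.≃-sym s≃X/n) (toℚᵘ-/ (+ Y) 0)
    ... | *≡* X*1≡Y*n =
      ℤ.+-injective (trans (≡.sym (ℤ.*-identityʳ (+ X))) (trans X*1≡Y*n (≡.sym (ℤ.pos-* Y (suc k)))))
    from : X ≡ Y * suc k → s ≡ (+ Y) / 1
    from X≡Yn = ℚ.toℚᵘ-injective (ℚᵘ.≃-trans s≃X/n (ℚᵘ.≃-trans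
      (*≡* (trans (ℤ.*-identityʳ (+ X)) (trans (cong +_ X≡Yn) (ℤ.pos-* Y (suc k)))))
      (ℚᵘ.≃-sym (toℚᵘ-/ (+ Y) 0))))

m≡n+[c∸1] : ∀ {m n} → 1 ≤ (m + 1) ∸ n → m ≡ n + ((m + 1) ∸ n ∸ 1)
m≡n+[c∸1] {m} {n} c≥1 = begin
  m                      ≡⟨ ℕ.m+[n∸m]≡n n≤m ⟨
  n + (m ∸ n)            ≡⟨ cong (_+_ n) (ℕ.m+n∸n≡m (m ∸ n) 1) ⟨
  n + ((m ∸ n) + 1 ∸ 1)  ≡⟨ cong (λ x → n + (x ∸ 1)) (ℕ.+-∸-comm 1 n≤m) ⟨
  n + ((m + 1) ∸ n ∸ 1)  ∎
  where
  open ≡-Reasoning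
  n≤m : n ≤ m
  n≤m = ℕ.m<1+n⇒m≤n (subst (n <_) (ℕ.+-comm m 1) (ℕ.m∸n≢0⇒n<m (ℕ.>⇒≢ c≥1)))

2[c∸1]≤n : ∀ {c n} → 2 * c ≤ n + 2 → 2 * (c ∸ 1) ≤ n
2[c∸1]≤n {c} {n} 2c≤n+2 = begin
  2 * (c ∸ 1)  ≡⟨ ℕ.*-distribˡ-∸ 2 c 1 ⟩
  2 * c ∸ 2    ≤⟨ ℕ.∸-monoˡ-≤ 2 2c≤n+2 ⟩
  n + 2 ∸ 2    ≡⟨ ℕ.m+n∸n≡m n 2 ⟩
  n            ∎
  where open ℕ.≤-Reasoning

[p+2c]∸2≡p+2[c∸1] : ∀ p {c} → 1 ≤ c → (p + 2 * c) ∸ 2 ≡ p + 2 * (c ∸ 1)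
[p+2c]∸2≡p+2[c∸1] p {c} c≥1 =
  trans (ℕ.+-∸-assoc p (ℕ.*-monoʳ-≤ 2 c≥1)) (cong (_+_ p) (≡.sym (ℕ.*-distribˡ-∸ 2 c 1)))

2[c∸1]≡0⇔c≡1 : ∀ {c} → 1 ≤ c → 2 * (c ∸ 1) ≡ 0 ⇔ c ≡ 1
2[c∸1]≡0⇔c≡1 {suc c} _ = mk⇔ (λ 2c≡0 → cong suc (ℕ.m+n≡0⇒m≡0 c 2c≡0)) (λ { refl → refl })

twice-edges : ∀ {n} (G : Graph n) → 1 ≤ cyclomatic G → 2 * edges G ≡ n + n + 2 * (cyclomatic G ∸ 1)
twice-edges {n} G c≥1 = trans (cong (2 *_) (m≡n+[c∸1] {edges G} {n} c≥1)) (double (cyclomatic G ∸ 1))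
  where
  double : ∀ x → 2 * (n + x) ≡ n + n + 2 * x
  double x = solve (n ∷ x ∷ [])

proposition34 : (k : ℕ) (G : Graph (suc k)) → Connected G →
    1 ≤ cyclomatic G → 2 * cyclomatic G ≤ suc k + 2 →
    (S G ℚ.≤ (+ (2 * ((pendent G + 2 * cyclomatic G) ∸ 2))) / 1)
    × ((S G ≡ (+ (2 * ((pendent G + 2 * cyclomatic G) ∸ 2))) / 1) ⇔ Unicyclic G)
proposition34 zero    G con () _
proposition34 (suc k) G con c≥1 2c≤n+2 =
  numerator-≤⇒≤ S≃X/n Y (subst (X ≤_) identity (ℕ.m≤m+n X (2 * a * L))) ,
  ⇔.trans S≡Y⇔c≡1 (mk⇔ (con ,_) proj₂)
  where
  n c a L Y X : ℕ
  n = suc (suc k)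
  c = cyclomatic G
  a = 2 * (c ∸ 1)
  L = ∑[ i < n ] large (degree G i)
  Y = 2 * ((pendent G + 2 * c) ∸ 2)
  X = ∑[ i < n ] ℤ.∣ degree G i * n ⊖ (n + n + a) ∣
  ∑d≡ : ∑[ i < n ] degree G i ≡ n + n + a
  ∑d≡ = trans (handshake G) (twice-edges G c≥1)
  S≃X/n : toℚᵘ (S G) ≃ᵘ mkℚᵘ (+ X) (suc k)
  S≃X/n = subst (λ M → toℚᵘ (S G) ≃ᵘ mkℚᵘ (+ ∑[ i < n ] ℤ.∣ degree G i * n ⊖ M ∣) (suc k))
                (twice-edges G c≥1) (toℚᵘ-S G)
  identity : X + 2 * a * L ≡ Y * n
  identity = trans (deviation-sum (degree G) ∑d≡ (2[c∸1]≤n {c} 2c≤n+2) (connected⇒degree≥1 G con))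
    (cong (λ p → 2 * p * n) (≡.sym (trans ([p+2c]∸2≡p+2[c∸1] (pendent G) c≥1)
                                          (cong (_+ a) (count-allFin (λ i → degree G i ≡ᵇ 1))))))
  S≡Y⇔c≡1 : S G ≡ (+ Y) / 1 ⇔ c ≡ 1
  S≡Y⇔c≡1 = ⇔.trans (≡⇔numerator-≡ S≃X/n Y) (⇔.trans (x+t≡y⇒[x≡y⇔t≡0] identity)
            (⇔.trans (2a*large≡0⇔a≡0 (degree G) ∑d≡) (2[c∸1]≡0⇔c≡1 c≥1)))
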